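{- Let $R$ be a commutative ring and let $G$ be a path graph with an edge labeling $\alpha$ over $R$. Then $(G,\alpha)$ satisfies the Universal Difference Property.
   Context: Graphs are finite. An edge labeling of a graph $G=(V,E)$ over a commutative ring $R$ is a function $\alpha:E\to\mathcal{I}(R)$ assigning to each edge an ideal of $R$. A (generalized) spline on $(G,\alpha)$ is a function $\rho:V\to R$ such that for each edge $ab$, $\rho(a)-\rho(b)\in\alpha(ab)$. For vertices $u,w$, $\mathcal{P}_{(u,w)}$ denotes the set of all paths in $G$ from $u$ to $w$, and for a path $P$ with edges $e_1,\dots,e_k$, $\alpha(P)=\alpha(e_1)+\cdots+\alpha(e_k)$. $(G,\alpha)$ satisfies the Universal Difference Property (UDP) if for every pair of vertices $u,w$ connected by a path in $G$ and every $x\in\bigcap_{P\in\mathcal{P}_{(u,w)}}\alpha(P)$ there exists a spline $\rho$ on $(G,\alpha)$ with $\rho(u)-\rho(w)=x$. -}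

module Defs where

open import Level using (Level; _⊔_; suc)
open import Algebra.Bundles using (CommutativeRing)
open import Data.Nat using (ℕ)
open import Data.Fin using (Fin; inject₁) renaming (suc to fsuc)
open import Data.List using (List; []; _∷_)
open import Data.List.Relation.Unary.Unique.Propositional using (Unique)
open import Data.Product using (Σ; Σ-syntax; ∃; _×_; _,_)
open import Data.Sum using (_⊎_)
open import Relation.Binary.PropositionalEquality using (_≡_)

-- Finite graphs (multigraphs allowed): vertices Fin n, edges Fin m,
-- each edge has two endpoints (its orientation is irrelevant below).

record Graph : Set where
  field
    nV  : ℕ
    nE  : ℕ
    end₁ : Fin nE → Fin nV
    end₂ : Fin nE → Fin nV

module _ (G : Graph) where
  open Graph G

  Joins : Fin nE → Fin nV → Fin nV → Set
  Joins e u v = (end₁ e ≡ u × end₂ e ≡ v) ⊎ (end₁ e ≡ v × end₂ e ≡ u)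

  data Walk : Fin nV → Fin nV → Set where
    []   : ∀ {u} → Walk u u
    step : ∀ {u v w} (e : Fin nE) → Joins e u v → Walk v w → Walk u w

  walkVertices : ∀ {u w} → Walk u w → List (Fin nV)
  walkVertices {u} []           = u ∷ []
  walkVertices {u} (step e j p) = u ∷ walkVertices p

  Path : Fin nV → Fin nV → Set
  Path u w = Σ[ p ∈ Walk u w ] Unique (walkVertices p)

module _ {c ℓ : Level} (R : CommutativeRing c ℓ) where
  open CommutativeRing R

  record Ideal (ℓi : Level) : Set (c ⊔ ℓ ⊔ suc ℓi) where
    field
      _∈I    : Carrier → Set ℓi
      ∈-resp : ∀ {x y} → x ≈ y → x ∈I → y ∈I
      0∈     : 0# ∈I
      +∈     : ∀ {x y} → x ∈I → y ∈I → (x + y) ∈I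
      *∈     : ∀ r {x} → x ∈I → (r * x) ∈I

  open Ideal public

  EdgeLabeling : (ℓi : Level) → Graph → Set (c ⊔ ℓ ⊔ suc ℓi)
  EdgeLabeling ℓi G = Fin (Graph.nE G) → Ideal ℓi

  module _ {ℓi : Level} (G : Graph) (α : EdgeLabeling ℓi G) where
    open Graph G

    -- x ∈ α(P) = α(e₁) + ... + α(eₖ)   (the empty sum is the zero ideal)
    InSumLabels : ∀ {u w} → Walk G u w → Carrier → Set (c ⊔ ℓ ⊔ ℓi)
    InSumLabels []           x = Level.Lift (c ⊔ ℓi) (x ≈ 0#)
    InSumLabels (step e j p) x =
      Σ[ a ∈ Carrier ] Σ[ b ∈ Carrier ]
        (_∈I (α e) a × InSumLabels p b × x ≈ a + b)

    IsSpline : (Fin nV → Carrier) → Set ℓi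
    IsSpline ρ = ∀ (e : Fin nE) → _∈I (α e) (ρ (end₁ e) - ρ (end₂ e))

    UDP : Set (c ⊔ ℓ ⊔ ℓi)
    UDP = ∀ (u w : Fin nV) → Path G u w → ∀ (x : Carrier) →
          (∀ (P : Path G u w) → InSumLabels (Data.Product.proj₁ P) x) →
          Σ[ ρ ∈ (Fin nV → Carrier) ] (IsSpline ρ × (ρ u - ρ w) ≈ x)

-- The path graph on k+1 vertices 0 — 1 — ... — k; edge i joins i and i+1.

pathGraph : ℕ → Graph
pathGraph k = record
  { nV = Data.Nat.suc k ; nE = k ; end₁ = inject₁ ; end₂ = fsuc }

-- Fix the target vertex w. Every vertex u ≠ w of the path graph has a neighbour one step
-- closer to w, across an edge that separates u from w; following these steps gives a path
-- from u to w. If x = a₁ + ⋯ + aₙ is a decomposition along this path, the spline is built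
-- edge by edge from the far end: after the spline ρ′ for the tail of the path is built, the
-- step across the edge e from u is corrected by adding the constant a₁ + (ρ′ v − ρ′ u) ∈ α(e)
-- on the side of e containing u. Such a one-sided constant is a spline because e is the
-- only edge between the two sides.
module Submission where

open import Defs
open import Level using (Level; lift)
open import Algebra.Bundles using (CommutativeRing)
import Algebra.Properties.AbelianGroup as AbelianGroupProperties
import Algebra.Properties.CommutativeSemigroup as CommutativeSemigroupProperties
import Algebra.Properties.Group as GroupProperties
import Algebra.Properties.Ring as RingProperties
open import Data.Bool using (Bool; true; false; not; if_then_else_)
open import Data.Fin using (Fin; toℕ; inject₁; lower₁) renaming (suc to fsuc)
open import Data.Fin.Properties
  using (_≟_; <-cmp; toℕ-injective; toℕ-inject₁; toℕ-lower₁; inject₁-lower₁; toℕ≤pred[n])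
open import Data.List.Relation.Unary.All as All using (All; []; _∷_)
open import Data.List.Relation.Unary.AllPairs using ([]; _∷_)
open import Data.List.Relation.Unary.Unique.Propositional using (Unique)
open import Data.Nat using (ℕ; zero; suc; _≤_; _<_; _≤?_; ∣_-_∣; s≤s)
open import Data.Nat.Induction using (<-wellFounded)
import Data.Nat.Properties as ℕₚ
open ℕₚ using (≤-refl; ≤-trans; ≤-reflexive; <⇒≤; <⇒≱; <⇒≢; n≮n; n<1+n; m<n⇒m<1+n)
open import Data.Product using (Σ-syntax; _×_; _,_)
open import Data.Sum using (inj₁; inj₂; swap)
open import Data.Unit using (⊤; tt)
open import Function using (_∘_)
open import Induction.WellFounded using (Acc; acc)
open import Relation.Binary using (tri<; tri≈; tri>)
open import Relation.Binary.PropositionalEquality as ≡ using (_≡_; _≢_)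
open import Relation.Nullary using (¬_; does; yes; no)
open import Relation.Nullary.Decidable using (dec-true; dec-false)
open import Relation.Nullary.Negation using (contradiction)
import Relation.Binary.Reasoning.Setoid as SetoidReasoning

module _ (G : Graph) where
  open Graph G

  record Separates (e : Fin nE) (s w : Fin nV) : Set where
    field
      side      : Fin nV → Bool
      only-cut  : ∀ f → f ≢ e → side (end₁ f) ≡ side (end₂ f)
      side-s    : side s ≡ true
      side-w    : side w ≡ false

  StepsSeparate : ∀ {u w} → Walk G u w → Set
  StepsSeparate []                       = ⊤
  StepsSeparate (step {u} {_} {w} e _ p) = Separates e u w × StepsSeparate p

  record DescentStep (height : Fin nV → ℕ) (w u : Fin nV) : Set where
    field
      edge      : Fin nE
      next      : Fin nV
      joins     : Joins G edge u next
      closer    : height next < height u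
      separates : Separates edge u w

  record Descent (w : Fin nV) : Set where
    field
      height  : Fin nV → ℕ
      descend : ∀ {u} → u ≢ w → DescentStep height w u

  module _ {w : Fin nV} (D : Descent w) where
    open Descent D

    descentWalk : ∀ u → Acc _<_ (height u) → Walk G u w
    descentWalk u (acc rs) with u ≟ w
    ... | yes ≡.refl = []
    ... | no u≢w     = step edge joins (descentWalk next (rs closer))
      where open DescentStep (descend u≢w)

    descentWalk-bounded : ∀ u (a : Acc _<_ (height u)) →
                          All (λ z → height z ≤ height u) (walkVertices G (descentWalk u a))
    descentWalk-bounded u (acc rs) with u ≟ w
    ... | yes ≡.refl = ≤-refl ∷ []
    ... | no u≢w     =
      ≤-refl ∷ All.map (λ h → ≤-trans h (<⇒≤ closer)) (descentWalk-bounded next (rs closer))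
      where open DescentStep (descend u≢w)

    descentWalk-unique : ∀ u (a : Acc _<_ (height u)) → Unique (walkVertices G (descentWalk u a))
    descentWalk-unique u (acc rs) with u ≟ w
    ... | yes ≡.refl = [] ∷ []
    ... | no u≢w     = All.map u∉ (descentWalk-bounded next (rs closer))
                       ∷ descentWalk-unique next (rs closer)
      where
      open DescentStep (descend u≢w)
      u∉ : ∀ {z} → height z ≤ height next → u ≢ z
      u∉ h ≡.refl = <⇒≱ closer h

    descentWalk-stepsSeparate : ∀ u (a : Acc _<_ (height u)) → StepsSeparate (descentWalk u a)
    descentWalk-stepsSeparate u (acc rs) with u ≟ w
    ... | yes ≡.refl = tt
    ... | no u≢w     = separates , descentWalk-stepsSeparate next (rs closer)
      where open DescentStep (descend u≢w)

module _ {c ℓ ℓi : Level} (R : CommutativeRing c ℓ) where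
  open CommutativeRing R
  open GroupProperties +-group using (ε⁻¹≈ε; x≈y⇒x∙y⁻¹≈ε)
  open AbelianGroupProperties +-abelianGroup using (⁻¹-anti-homo‿-; ⁻¹-∙-comm)
  open CommutativeSemigroupProperties +-commutativeSemigroup using (interchange; x∙yz≈y∙xz)
  open SetoidReasoning setoid

  infix 4 _∈_
  _∈_ : Carrier → Ideal R ℓi → Set ℓi
  x ∈ I = _∈I I x

  module _ (I : Ideal R ℓi) where

    -‿∈ : ∀ {x} → x ∈ I → - x ∈ I
    -‿∈ x∈I = ∈-resp I (RingProperties.-1*x≈-x ring _) (*∈ I (- 1#) x∈I)

    -∈ : ∀ {x y} → x ∈ I → y ∈ I → x - y ∈ I
    -∈ x∈I y∈I = +∈ I x∈I (-‿∈ y∈I)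

    ≈⇒-∈ : ∀ {x y} → x ≈ y → x - y ∈ I
    ≈⇒-∈ x≈y = ∈-resp I (sym (x≈y⇒x∙y⁻¹≈ε x≈y)) (0∈ I)

  x+[a+[y-x]]≈a+y : ∀ x a y → x + (a + (y - x)) ≈ a + y
  x+[a+[y-x]]≈a+y x a y = begin
    x + (a + (y - x)) ≈⟨ x∙yz≈y∙xz x a (y - x) ⟩
    a + (x + (y - x)) ≈⟨ +-congˡ (x∙yz≈y∙xz x y (- x)) ⟩
    a + (y + (x - x)) ≈⟨ +-congˡ (+-congˡ (-‿inverseʳ x)) ⟩
    a + (y + 0#)      ≈⟨ +-congˡ (+-identityʳ y) ⟩
    a + y             ∎

  [p+q]-[r+s]≈[p-r]+[q-s] : ∀ p q r s → (p + q) - (r + s) ≈ (p - r) + (q - s)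
  [p+q]-[r+s]≈[p-r]+[q-s] p q r s = begin
    (p + q) - (r + s)     ≈⟨ +-congˡ (sym (⁻¹-∙-comm r s)) ⟩
    (p + q) + (- r + - s) ≈⟨ interchange p q (- r) (- s) ⟩
    (p - r) + (q - s)     ∎

  indicator : ∀ {n} → (Fin n → Bool) → Carrier → Fin n → Carrier
  indicator side a z = if side z then a else 0#

  module _ (G : Graph) (α : EdgeLabeling R ℓi G) where
    open Graph G

    +-isSpline : ∀ {ρ σ} → IsSpline R G α ρ → IsSpline R G α σ → IsSpline R G α (λ z → ρ z + σ z)
    +-isSpline {ρ} {σ} ρ-spline σ-spline e =
      ∈-resp (α e) (sym ([p+q]-[r+s]≈[p-r]+[q-s] (ρ (end₁ e)) (σ (end₁ e)) (ρ (end₂ e)) (σ (end₂ e))))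
        (+∈ (α e) (ρ-spline e) (σ-spline e))

    isSpline-joins : ∀ {ρ e u v} → IsSpline R G α ρ → Joins G e u v → ρ u - ρ v ∈ α e
    isSpline-joins {e = e} ρ-spline (inj₁ (≡.refl , ≡.refl)) = ρ-spline e
    isSpline-joins {ρ} {e} ρ-spline (inj₂ (≡.refl , ≡.refl)) =
      ∈-resp (α e) (⁻¹-anti-homo‿- (ρ (end₁ e)) (ρ (end₂ e))) (-‿∈ (α e) (ρ-spline e))

    indicator-isSpline : ∀ {e s w a} (sep : Separates G e s w) → a ∈ α e →
                         IsSpline R G α (indicator (Separates.side sep) a)
    indicator-isSpline {e} {a = a} sep a∈ f with f ≟ e
    ... | yes ≡.refl = -∈ (α e) (value∈ (side (end₁ e))) (value∈ (side (end₂ e)))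
      where
      open Separates sep
      value∈ : ∀ b → (if b then a else 0#) ∈ α e
      value∈ true  = a∈
      value∈ false = 0∈ (α e)
    ... | no f≢e = ≈⇒-∈ (α f) (reflexive (≡.cong (if_then a else 0#) (only-cut f f≢e)))
      where open Separates sep

    -- The spline is normalised to vanish at the target, so each step only has to fix its value at u.
    spline-along : ∀ {u w x} (p : Walk G u w) → StepsSeparate G p → InSumLabels R G α p x →
                   Σ[ ρ ∈ (Fin nV → Carrier) ] (IsSpline R G α ρ × ρ u ≈ x × ρ w ≈ 0#)
    spline-along [] _ (lift x≈0) = (λ _ → 0#) , (λ e → ≈⇒-∈ (α e) refl) , sym x≈0 , refl
    spline-along {u} {w} {x} (step {v = v} e joins p) (sep , seps) (a , b , a∈ , b∈ , x≈a+b)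
      with spline-along p seps b∈
    ... | ρ′ , ρ′-spline , ρ′v≈b , ρ′w≈0 =
      (λ z → ρ′ z + σ z) , +-isSpline {ρ′} {σ} ρ′-spline (indicator-isSpline sep correction∈) ,
      value-u , value-w
      where
      open Separates sep
      correction : Carrier
      correction = a + (ρ′ v - ρ′ u)
      correction∈ : correction ∈ α e
      correction∈ = +∈ (α e) a∈ (isSpline-joins ρ′-spline (swap joins))
      σ : Fin nV → Carrier
      σ = indicator side correction
      value-u : ρ′ u + σ u ≈ x
      value-u = begin
        ρ′ u + σ u        ≡⟨ ≡.cong (λ b → ρ′ u + (if b then correction else 0#)) side-s ⟩
        ρ′ u + correction ≈⟨ x+[a+[y-x]]≈a+y (ρ′ u) a (ρ′ v) ⟩
        a + ρ′ v          ≈⟨ +-congˡ ρ′v≈b ⟩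
        a + b             ≈⟨ sym x≈a+b ⟩
        x                 ∎
      value-w : ρ′ w + σ w ≈ 0#
      value-w = begin
        ρ′ w + σ w ≡⟨ ≡.cong (λ b → ρ′ w + (if b then correction else 0#)) side-w ⟩
        ρ′ w + 0#  ≈⟨ +-identityʳ (ρ′ w) ⟩
        ρ′ w       ≈⟨ ρ′w≈0 ⟩
        0#         ∎

    descents⇒UDP : (∀ w → Descent G w) → UDP R G α
    descents⇒UDP descent u w _ x x∈α[P] =
      let ρ , ρ-spline , ρu≈x , ρw≈0 = spline-along p (descentWalk-stepsSeparate G D u a)
                                         (x∈α[P] (p , descentWalk-unique G D u a))
      in ρ , ρ-spline , (begin
        ρ u - ρ w ≈⟨ +-cong ρu≈x (-‿cong ρw≈0) ⟩
        x - 0#    ≈⟨ +-congˡ ε⁻¹≈ε ⟩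
        x + 0#    ≈⟨ +-identityʳ x ⟩
        x         ∎)
      where
      D : Descent G w
      D = descent w
      a : Acc _<_ (Descent.height D u)
      a = <-wellFounded (Descent.height D u)
      p : Walk G u w
      p = descentWalk G D u a

∣1+m-n∣<∣m-n∣ : ∀ {m n} → m < n → ∣ suc m - n ∣ < ∣ m - n ∣
∣1+m-n∣<∣m-n∣ {zero}  {suc n} _         = n<1+n n
∣1+m-n∣<∣m-n∣ {suc m} {suc n} (s≤s m<n) = ∣1+m-n∣<∣m-n∣ m<n

∣m-n∣<∣1+m-n∣ : ∀ {m n} → n ≤ m → ∣ m - n ∣ < ∣ suc m - n ∣
∣m-n∣<∣1+m-n∣ {zero}  {zero}  _         = n<1+n 0
∣m-n∣<∣1+m-n∣ {suc m} {zero}  _         = n<1+n (suc m)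
∣m-n∣<∣1+m-n∣ {suc m} {suc n} (s≤s n≤m) = ∣m-n∣<∣1+m-n∣ n≤m

module _ {k : ℕ} where

  atMost : ℕ → Fin (suc k) → Bool
  atMost t z = does (toℕ z ≤? t)

  atMost-true : ∀ {t} z → toℕ z ≤ t → atMost t z ≡ true
  atMost-true {t} z = dec-true (toℕ z ≤? t)

  atMost-false : ∀ {t} z → ¬ toℕ z ≤ t → atMost t z ≡ false
  atMost-false {t} z = dec-false (toℕ z ≤? t)

  atMost-cut : ∀ t (f : Fin k) → toℕ f ≢ t → atMost t (inject₁ f) ≡ atMost t (fsuc f)
  atMost-cut t f f≢t with ℕₚ.<-cmp (toℕ f) t
  ... | tri< f<t _ _ = ≡.trans (atMost-true (inject₁ f) (≤-trans (≤-reflexive (toℕ-inject₁ f)) (<⇒≤ f<t)))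
                               (≡.sym (atMost-true (fsuc f) f<t))
  ... | tri≈ _ f≡t _ = contradiction f≡t f≢t
  ... | tri> _ _ t<f = ≡.trans (atMost-false (inject₁ f) (<⇒≱ (≡.subst (t <_) (≡.sym (toℕ-inject₁ f)) t<f)))
                               (≡.sym (atMost-false (fsuc f) (<⇒≱ (m<n⇒m<1+n t<f))))

  module _ (w : Fin (suc k)) where

    distanceTo : Fin (suc k) → ℕ
    distanceTo z = ∣ toℕ z - toℕ w ∣

    upwardStep : ∀ (e : Fin k) → toℕ e < toℕ w → DescentStep (pathGraph k) distanceTo w (inject₁ e)
    upwardStep e e<w = record
      { edge      = e
      ; next      = fsuc e
      ; joins     = inj₁ (≡.refl , ≡.refl)
      ; closer    = ≡.subst (λ n → ∣ suc (toℕ e) - toℕ w ∣ < ∣ n - toℕ w ∣) (≡.sym (toℕ-inject₁ e))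
                      (∣1+m-n∣<∣m-n∣ e<w)
      ; separates = record
        { side     = atMost (toℕ e)
        ; only-cut = λ f f≢e → atMost-cut (toℕ e) f (f≢e ∘ toℕ-injective)
        ; side-s   = atMost-true (inject₁ e) (≤-reflexive (toℕ-inject₁ e))
        ; side-w   = atMost-false w (<⇒≱ e<w)
        }
      }

    downwardStep : ∀ (e : Fin k) → toℕ w ≤ toℕ e → DescentStep (pathGraph k) distanceTo w (fsuc e)
    downwardStep e w≤e = record
      { edge      = e
      ; next      = inject₁ e
      ; joins     = inj₂ (≡.refl , ≡.refl)
      ; closer    = ≡.subst (λ n → ∣ n - toℕ w ∣ < ∣ suc (toℕ e) - toℕ w ∣) (≡.sym (toℕ-inject₁ e))
                      (∣m-n∣<∣1+m-n∣ w≤e)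
      ; separates = record
        { side     = not ∘ atMost (toℕ e)
        ; only-cut = λ f f≢e → ≡.cong not (atMost-cut (toℕ e) f (f≢e ∘ toℕ-injective))
        ; side-s   = ≡.cong not (atMost-false (fsuc e) (n≮n (toℕ e)))
        ; side-w   = ≡.cong not (atMost-true w w≤e)
        }
      }

    pathGraph-descent : Descent (pathGraph k) w
    pathGraph-descent = record { height = distanceTo ; descend = λ {u} → descend u }
      where
      descend : ∀ u → u ≢ w → DescentStep (pathGraph k) distanceTo w u
      descend u u≢w with <-cmp u w
      ... | tri< u<w _ _ = ≡.subst (DescentStep (pathGraph k) distanceTo w) (inject₁-lower₁ u k≢u)
                             (upwardStep (lower₁ u k≢u)
                               (≡.subst (_< toℕ w) (≡.sym (toℕ-lower₁ u k≢u)) u<w))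
        where
        k≢u : k ≢ toℕ u
        k≢u k≡u = <⇒≢ (≤-trans u<w (toℕ≤pred[n] w)) (≡.sym k≡u)
      ... | tri≈ _ u≡w _ = contradiction u≡w u≢w
      descend (fsuc e) _ | tri> _ _ (s≤s w≤e) = downwardStep e w≤e

mainTheorem2 : ∀ {c ℓ ℓi : Level} (R : CommutativeRing c ℓ) (k : ℕ)
                 (α : EdgeLabeling R ℓi (pathGraph k)) →
                 UDP R (pathGraph k) α
mainTheorem2 R k α = descents⇒UDP R (pathGraph k) α pathGraph-descent
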